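{- Let $\Gamma$ be a graph in $NG(v,k,\lambda;m,s)$ with $k-\lambda-s+m-1=0$ and $m\geq 3$. Then $\Gamma$ is isomorphic to the complete multipartite graph $K_{s\times 2}$ ($s$ parts, each of size $2$).
   Context: All graphs are finite, simple and undirected. A graph on $v$ vertices is edge-regular with parameters $(v,k,\lambda)$ if it has at least one edge, is $k$-regular, and every two adjacent vertices have exactly $\lambda$ common neighbours. A clique $S$ in a regular graph is $m$-regular if every vertex not in $S$ is adjacent to exactly $m>0$ vertices of $S$; an $s$-clique is a clique of size $s$. $NG(v,k,\lambda;m,s)$ denotes the set of non-complete edge-regular graphs with parameters $(v,k,\lambda)$ that contain an $m$-regular $s$-clique with $s\geq 2$. $K_{r\times t}$ is the complete multipartite graph with $r$ parts of size $t$. -}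

module Defs where

open import Data.Nat using (ℕ; _+_; _∸_; _≥_; _>_)
open import Data.Bool using (Bool; true; false; _∧_; not)
open import Data.Fin using (Fin)
open import Data.Fin.Subset using (Subset; _∈_; _∉_; ∣_∣)
open import Data.Vec using (Vec; tabulate)
open import Data.Fin.Properties using (_≟_)
open import Data.Product using (Σ; _×_; _,_; proj₁; proj₂; ∃)
open import Relation.Nullary using (¬_; does)
open import Relation.Binary.PropositionalEquality using (_≡_; _≢_)
open import Function.Bundles using (_⤖_; Bijection)

record Graph (n : ℕ) : Set where
  field
    adj   : Fin n → Fin n → Bool
    sym   : ∀ x y → adj x y ≡ adj y x
    irrefl : ∀ x → adj x x ≡ false

open Graph public

Adjacent : ∀ {n} → Graph n → Fin n → Fin n → Set
Adjacent G x y = adj G x y ≡ true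

N : ∀ {n} → Graph n → Fin n → Subset n
N G x = tabulate (adj G x)

CN : ∀ {n} → Graph n → Fin n → Fin n → Subset n
CN G x y = tabulate (λ z → adj G x z ∧ adj G y z)

degIn : ∀ {n} → Graph n → Subset n → Fin n → ℕ
degIn G S x = ∣ tabulate (λ z → adj G x z ∧ Data.Vec.lookup S z) ∣
  where import Data.Vec

Regular : ∀ {n} → Graph n → ℕ → Set
Regular G k = ∀ x → ∣ N G x ∣ ≡ k

HasEdge : ∀ {n} → Graph n → Set
HasEdge G = ∃ λ x → ∃ λ y → Adjacent G x y

EdgeRegular : ∀ {n} → Graph n → ℕ → ℕ → Set
EdgeRegular G k l =
  HasEdge G × Regular G k × (∀ x y → Adjacent G x y → ∣ CN G x y ∣ ≡ l)

Complete : ∀ {n} → Graph n → Set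
Complete G = ∀ x y → x ≢ y → Adjacent G x y

IsClique : ∀ {n} → Graph n → Subset n → Set
IsClique G S = ∀ x y → x ∈ S → y ∈ S → x ≢ y → Adjacent G x y

IsRegularClique : ∀ {n} → Graph n → ℕ → Subset n → Set
IsRegularClique G m S =
  IsClique G S × m > 0 × (∀ x → x ∉ S → degIn G S x ≡ m)

-- membership in NG(v,k,λ;m,s), with v = n
InNG : ∀ {n} → Graph n → ℕ → ℕ → ℕ → ℕ → Set
InNG G k l m s =
  ¬ Complete G × EdgeRegular G k l × s ≥ 2 ×
  (Σ (Subset _) λ S → ∣ S ∣ ≡ s × IsRegularClique G m S)

KAdj : (r t : ℕ) → (Fin r × Fin t) → (Fin r × Fin t) → Bool
KAdj r t (i , _) (j , _) = not (does (i ≟ j))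

IsoToK : ∀ {n} → Graph n → (r t : ℕ) → Set
IsoToK {n} G r t =
  Σ (Fin n ⤖ (Fin r × Fin t)) λ f →
    ∀ x y → adj G x y ≡ KAdj r t (Bijection.to f x) (Bijection.to f y)

module Submission where

-- Let S be the m-regular s-clique.  The parameter identity says that for every
-- edge xy the set N(x) ∖ N(y) of private neighbours of x has s + 1 − m elements,
-- whereas every vertex outside S misses exactly s − m vertices of S.  Every step
-- of the argument compares two such counts through an inclusion of sets with
-- extra elements.  In turn we obtain: a clique neighbour y of an outside vertex x
-- passes its other outside neighbours on to x; any two outside vertices are
-- adjacent (here m ≥ 3 is used); every outside vertex misses exactly one clique
-- vertex, whence s = m + 1, and every clique vertex misses exactly one outside
-- vertex.  So each vertex x has a unique non-neighbour μ x on the other side of S,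
-- μ is an involution, and x, y are non-adjacent iff y ∈ {x, μ x}: Γ is the
-- complement of a perfect matching between S and its complement, i.e. K_{s×2}.

open import Defs hiding (sym)
open import Data.Nat using (ℕ; zero; suc; _+_; _≤_; _<_; _≥_; z≤n; s≤s; _≤?_)
open import Data.Nat.Properties hiding (_≟_)
open import Data.Bool using (Bool; true; false; _∧_; _∨_; not; _xor_; if_then_else_)
open import Data.Bool.Properties using (∧-comm; xor-comm) renaming (_≟_ to _≟ᵇ_)
open import Data.Fin using (Fin; zero; suc; toℕ; fromℕ<)
open import Data.Fin.Properties using (_≟_; any?; toℕ-fromℕ<; toℕ-injective; toℕ<n)
open import Data.Fin.Subset using (Subset; ∣_∣; _∉_)
open import Data.Vec using (tabulate; lookup)
open import Data.Vec.Properties using (tabulate∘lookup; lookup⇒[]=; []=⇒lookup)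
open import Data.Product using (_×_; _,_; proj₁; proj₂; ∃)
open import Data.Sum using (_⊎_; inj₁; inj₂)
open import Data.Empty using (⊥; ⊥-elim)
open import Function.Bundles using (mk⤖)
open import Relation.Nullary using (¬_; does; yes; no)
open import Relation.Nullary.Decidable using (dec-true; dec-false)
open import Relation.Binary.PropositionalEquality

private variable
  n : ℕ
  a b c : Bool

true≢false : true ≢ false
true≢false ()

∧-intro : a ≡ true → b ≡ true → a ∧ b ≡ true
∧-intro refl refl = refl

∧-elim : a ∧ b ≡ true → a ≡ true × b ≡ true
∧-elim {true} {true} _ = refl , refl

∧-not-intro : a ≡ true → b ≡ false → a ∧ not b ≡ true
∧-not-intro refl refl = refl

∧-not-elim : a ∧ not b ≡ true → a ≡ true × b ≡ false
∧-not-elim {true} {false} _ = refl , refl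

∧-falseˡ : a ≡ false → a ∧ b ≡ false
∧-falseˡ refl = refl

∧-falseʳ : b ≡ false → a ∧ b ≡ false
∧-falseʳ {a = true} refl = refl
∧-falseʳ {a = false} refl = refl

∨-introʳ : b ≡ true → a ∨ b ≡ true
∨-introʳ {a = true} _ = refl
∨-introʳ {a = false} e = e

not-true : not a ≡ true → a ≡ false
not-true {false} _ = refl

xor-true : a xor b ≡ true → b ≡ not a
xor-true {true} {false} _ = refl
xor-true {false} {true} _ = refl

xor-∧-not : a ≢ b → c ≡ false → (a xor b) ∧ not c ≡ true
xor-∧-not {true} {true} a≢b _ = ⊥-elim (a≢b refl)
xor-∧-not {true} {false} _ refl = refl
xor-∧-not {false} {true} _ refl = refl
xor-∧-not {false} {false} a≢b _ = ⊥-elim (a≢b refl)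

+-positiveʳ : {a c : ℕ} → suc a ≤ a + c → 1 ≤ c
+-positiveʳ {a} {c} le = +-cancelˡ-≤ a 1 c (≤-trans (≤-reflexive (+-comm a 1)) le)

one-more : {a b m s : ℕ} → b + m ≡ s + 1 → a + m ≡ s → b ≡ a + 1
one-more {a} {b} {m} {s} bm am = +-cancelʳ-≡ m b (a + 1) (begin
  b + m        ≡⟨ bm ⟩
  s + 1        ≡⟨ cong (_+ 1) am ⟨
  a + m + 1    ≡⟨ +-assoc a m 1 ⟩
  a + (m + 1)  ≡⟨ cong (a +_) (+-comm m 1) ⟩
  a + (1 + m)  ≡⟨ +-assoc a 1 m ⟨
  a + 1 + m    ∎)
  where open ≡-Reasoning

-- two disjoint sets, each missing at most one of m elements, fit into m only if m ≤ 2
two-halves : {m a c : ℕ} → m ≤ a + 1 → m ≤ c + 1 → a + c ≤ m → m ≤ 2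
two-halves {m} {a} {c} ma mc acm = +-cancelˡ-≤ m m 2 (begin
  m + m              ≤⟨ +-mono-≤ ma mc ⟩
  a + 1 + (c + 1)    ≡⟨ +-assoc a 1 (c + 1) ⟩
  a + (1 + (c + 1))  ≡⟨ cong (a +_) (+-comm 1 (c + 1)) ⟩
  a + (c + 1 + 1)    ≡⟨ cong (a +_) (+-assoc c 1 1) ⟩
  a + (c + 2)        ≡⟨ +-assoc a c 2 ⟨
  a + c + 2          ≤⟨ +-monoˡ-≤ 2 acm ⟩
  m + 2              ∎)
  where open ≤-Reasoning

Pred : ℕ → Set
Pred n = Fin n → Bool

_∩_ _∪_ _∖_ : Pred n → Pred n → Pred n
(f ∩ g) i = f i ∧ g i
(f ∪ g) i = f i ∨ g i
(f ∖ g) i = f i ∧ not (g i)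

⁅_⁆ : Fin n → Pred n
⁅ i ⁆ j = does (j ≟ i)

_⊆_ : Pred n → Pred n → Set
f ⊆ g = ∀ i → f i ≡ true → g i ≡ true

⁅⁆-self : (i : Fin n) → ⁅ i ⁆ i ≡ true
⁅⁆-self i = dec-true (i ≟ i) refl

⁅⁆-other : {i j : Fin n} → j ≢ i → ⁅ i ⁆ j ≡ false
⁅⁆-other {i = i} {j} j≢i = dec-false (j ≟ i) j≢i

⁅⁆-elim : {i j : Fin n} → ⁅ i ⁆ j ≡ true → j ≡ i
⁅⁆-elim {i = i} {j} e with j ≟ i
... | yes j≡i = j≡i

⁅⁆-suc : (i j : Fin n) → ⁅ suc i ⁆ (suc j) ≡ ⁅ i ⁆ j
⁅⁆-suc i j with j ≟ i
... | yes _ = refl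
... | no _ = refl

indicator : Bool → ℕ
indicator true = 1
indicator false = 0

count : Pred n → ℕ
count {zero} f = 0
count {suc n} f = indicator (f zero) + count (λ i → f (suc i))

count-ext : {f g : Pred n} → (∀ i → f i ≡ g i) → count f ≡ count g
count-ext {zero} _ = refl
count-ext {suc n} f≗g = cong₂ _+_ (cong indicator (f≗g zero)) (count-ext (λ i → f≗g (suc i)))

count-empty : {f : Pred n} → (∀ i → f i ≡ false) → count f ≡ 0
count-empty {zero} _ = refl
count-empty {suc n} none rewrite none zero = count-empty (λ i → none (suc i))

count-singleton : (i : Fin n) → count ⁅ i ⁆ ≡ 1
count-singleton {suc n} zero = cong suc (count-empty {n} (λ j → ⁅⁆-other {i = zero} {j = suc j} λ ()))
count-singleton {suc n} (suc i) = trans (count-ext (⁅⁆-suc i)) (count-singleton i)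

count-nonempty : {f : Pred n} (i : Fin n) → f i ≡ true → 1 ≤ count f
count-nonempty {f = f} zero fi rewrite fi = s≤s z≤n
count-nonempty {f = f} (suc i) fi =
  ≤-trans (count-nonempty {f = λ j → f (suc j)} i fi) (m≤n+m _ (indicator (f zero)))

count-witness : {f : Pred n} → 1 ≤ count f → ∃ λ i → f i ≡ true
count-witness {zero} ()
count-witness {suc n} {f} pos with f zero in f0
... | true = zero , f0
... | false with count-witness {f = λ i → f (suc i)} pos
...   | i , fi = suc i , fi

count-split : (f g : Pred n) → count f ≡ count (f ∩ g) + count (f ∖ g)
count-split {zero} f g = refl
count-split {suc n} f g with f zero | g zero
... | true  | true  = cong suc (count-split (λ i → f (suc i)) (λ i → g (suc i)))
... | true  | false = trans (cong suc (count-split (λ i → f (suc i)) (λ i → g (suc i)))) (sym (+-suc _ _))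
... | false | true  = count-split (λ i → f (suc i)) (λ i → g (suc i))
... | false | false = count-split (λ i → f (suc i)) (λ i → g (suc i))

count-⊆ : {f g : Pred n} → f ⊆ g → count g ≡ count f + count (g ∖ f)
count-⊆ {f = f} {g} f⊆g = trans (count-split g f) (cong (_+ count (g ∖ f)) (count-ext g∩f≗f))
  where
  g∩f≗f : ∀ i → (g ∩ f) i ≡ f i
  g∩f≗f i with f i in fi
  ... | true = cong (_∧ true) (f⊆g i fi)
  ... | false = ∧-falseʳ refl

count-mono : {f g : Pred n} → f ⊆ g → count f ≤ count g
count-mono f⊆g = ≤-trans (m≤m+n _ _) (≤-reflexive (sym (count-⊆ f⊆g)))

count-pair : {f : Pred n} {i j : Fin n} → i ≢ j → f i ≡ true → f j ≡ true → 2 ≤ count f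
count-pair {f = f} {i} {j} i≢j fi fj = begin
  1 + 1                                ≤⟨ +-mono-≤ (count-nonempty i (∧-intro fi (⁅⁆-self i)))
                                            (count-nonempty j (∧-not-intro fj (⁅⁆-other (≢-sym i≢j)))) ⟩
  count (f ∩ ⁅ i ⁆) + count (f ∖ ⁅ i ⁆) ≡⟨ count-split f ⁅ i ⁆ ⟨
  count f                              ∎
  where open ≤-Reasoning

count-gap : {f g : Pred n} {d : ℕ} → f ⊆ g → d ≤ count (g ∖ f) → d + count f ≤ count g
count-gap {f = f} {g} {d} f⊆g d≤gap = begin
  d + count f             ≤⟨ +-monoˡ-≤ (count f) d≤gap ⟩
  count (g ∖ f) + count f ≡⟨ +-comm (count (g ∖ f)) (count f) ⟩
  count f + count (g ∖ f) ≡⟨ count-⊆ f⊆g ⟨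
  count g                 ∎
  where open ≤-Reasoning

count-extra : {f g : Pred n} (i : Fin n) → f ⊆ g → g i ≡ true → f i ≡ false → 1 + count f ≤ count g
count-extra i f⊆g gi fi = count-gap f⊆g (count-nonempty i (∧-not-intro gi fi))

count-extra₂ : {f g : Pred n} (i j : Fin n) → f ⊆ g → i ≢ j →
               g i ≡ true → f i ≡ false → g j ≡ true → f j ≡ false → 2 + count f ≤ count g
count-extra₂ i j f⊆g i≢j gi fi gj fj = count-gap f⊆g (count-pair i≢j (∧-not-intro gi fi) (∧-not-intro gj fj))

count-two : {f : Pred n} → 2 ≤ count f → ∃ λ i → ∃ λ j → i ≢ j × f i ≡ true × f j ≡ true
count-two {f = f} two with count-witness (≤-trans (n≤1+n 1) two)
... | i , fi with count-witness {f = f ∖ ⁅ i ⁆} rest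
  where
  atMostOne : count (f ∩ ⁅ i ⁆) ≤ 1
  atMostOne = ≤-trans (count-mono {f = f ∩ ⁅ i ⁆} {g = ⁅ i ⁆} (λ j h → proj₂ (∧-elim h)))
                      (≤-reflexive (count-singleton i))
  rest : 1 ≤ count (f ∖ ⁅ i ⁆)
  rest = +-cancelˡ-≤ 1 1 _ (begin
    1 + 1                                ≤⟨ two ⟩
    count f                              ≡⟨ count-split f ⁅ i ⁆ ⟩
    count (f ∩ ⁅ i ⁆) + count (f ∖ ⁅ i ⁆) ≤⟨ +-monoˡ-≤ _ atMostOne ⟩
    1 + count (f ∖ ⁅ i ⁆)                ∎)
    where open ≤-Reasoning
... | j , hj = i , j , i≢j , fi , proj₁ (∧-not-elim hj)
  where
  i≢j : i ≢ j
  i≢j refl = true≢false (trans (sym (⁅⁆-self i)) (proj₂ (∧-not-elim hj)))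

count-≤1 : {f : Pred n} → (∀ i j → f i ≡ true → f j ≡ true → i ≢ j → ⊥) → count f ≤ 1
count-≤1 {f = f} noPair with count f ≤? 1
... | yes ≤1 = ≤1
... | no ≰1 with count-two (≰⇒> ≰1)
...   | i , j , i≢j , fi , fj = ⊥-elim (noPair i j fi fj i≢j)

count-≤1-unique : {f : Pred n} {i j : Fin n} → count f ≤ 1 → f i ≡ true → f j ≡ true → i ≡ j
count-≤1-unique {i = i} {j} ≤1 fi fj with i ≟ j
... | yes i≡j = i≡j
... | no i≢j = ⊥-elim (1+n≰n (≤-trans (count-pair i≢j fi fj) ≤1))

count-∪ : (f g : Pred n) → count (f ∪ g) ≤ count f + count g
count-∪ f g = begin
  count (f ∪ g)                             ≡⟨ count-split (f ∪ g) f ⟩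
  count ((f ∪ g) ∩ f) + count ((f ∪ g) ∖ f) ≤⟨ +-mono-≤ (≤-reflexive (count-ext absorb))
                                                         (count-mono onlyG) ⟩
  count f + count g                         ∎
  where
  open ≤-Reasoning
  absorb : ∀ i → ((f ∪ g) ∩ f) i ≡ f i
  absorb i with f i
  ... | true = refl
  ... | false = ∧-falseʳ refl
  onlyG : ((f ∪ g) ∖ f) ⊆ g
  onlyG i h with f i
  ... | true = ⊥-elim (true≢false (sym h))
  ... | false = proj₁ (∧-elim h)

count-disjoint : {f g h : Pred n} → f ⊆ h → g ⊆ h → (∀ i → f i ≡ true → g i ≡ false) →
                 count f + count g ≤ count h
count-disjoint {f = f} {g} {h} f⊆h g⊆h disjoint = begin
  count f + count g       ≤⟨ +-monoʳ-≤ (count f) (count-mono g⊆h∖f) ⟩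
  count f + count (h ∖ f) ≡⟨ count-⊆ f⊆h ⟨
  count h                 ∎
  where
  open ≤-Reasoning
  g⊆h∖f : g ⊆ (h ∖ f)
  g⊆h∖f i gi with f i in fi
  ... | true = ⊥-elim (true≢false (trans (sym gi) (disjoint i fi)))
  ... | false = ∧-not-intro (g⊆h i gi) refl

-- The rank of i in f (the number of elements of f before i) enumerates f by Fin (count f).

rank : Pred n → Fin n → ℕ
rank f zero = 0
rank f (suc i) = indicator (f zero) + rank (λ j → f (suc j)) i

rank-< : {f : Pred n} {i : Fin n} → f i ≡ true → rank f i < count f
rank-< {f = f} {zero} fi rewrite fi = s≤s z≤n
rank-< {f = f} {suc i} fi = +-monoʳ-< (indicator (f zero)) (rank-< {f = λ j → f (suc j)} fi)

rank-injective : {f : Pred n} {i j : Fin n} → f i ≡ true → f j ≡ true → rank f i ≡ rank f j → i ≡ j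
rank-injective {i = zero} {zero} _ _ _ = refl
rank-injective {f = f} {zero} {suc j} fi _ r rewrite fi = ⊥-elim (0≢1+n r)
rank-injective {f = f} {suc i} {zero} _ fj r rewrite fj = ⊥-elim (0≢1+n (sym r))
rank-injective {f = f} {suc i} {suc j} fi fj r =
  cong suc (rank-injective {f = λ k → f (suc k)} fi fj (+-cancelˡ-≡ (indicator (f zero)) _ _ r))

rank-surjective : {f : Pred n} (r : ℕ) → r < count f → ∃ λ i → f i ≡ true × rank f i ≡ r
rank-surjective {zero} r ()
rank-surjective {suc n} {f} r r<count with f zero in f0
rank-surjective {suc n} {f} zero _ | true = zero , f0 , refl
rank-surjective {suc n} {f} (suc r) (s≤s r<count) | true
  with rank-surjective {f = λ j → f (suc j)} r r<count
... | i , fi , ri = suc i , fi , trans (cong (λ b → indicator b + rank (λ j → f (suc j)) i) f0) (cong suc ri)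
rank-surjective {suc n} {f} r r<count | false
  with rank-surjective {f = λ j → f (suc j)} r r<count
... | i , fi , ri = suc i , fi , trans (cong (λ b → indicator b + rank (λ j → f (suc j)) i) f0) ri

-- If the only non-neighbours of
-- each vertex x are x itself and μ x, the graph is K_{s×2}: its parts are the
-- pairs {y, μ y} with y ∈ S, numbered by the rank of y in S, and the position
-- inside a part records whether the vertex lies in S.
module MatchingComplement {v s : ℕ} (G : Graph v) (S : Pred v) (size : count S ≡ s)
  (μ : Fin v → Fin v)
  (μ-flips : ∀ x → S (μ x) ≡ not (S x))
  (μ-involutive : ∀ x → μ (μ x) ≡ x)
  (μ-nonadjacent : ∀ x → adj G x (μ x) ≡ false)
  (nonadjacent⇒μ : ∀ x y → adj G x y ≡ false → y ≡ x ⊎ y ≡ μ x)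
  where

  root : Fin v → Fin v
  root x = if S x then x else μ x

  root-in : ∀ x → S (root x) ≡ true
  root-in x with S x in e
  ... | true = e
  ... | false = trans (μ-flips x) (cong not e)

  root-member : ∀ x → S x ≡ true → root x ≡ x
  root-member x e rewrite e = refl

  root-μ : ∀ x → root (μ x) ≡ root x
  root-μ x with S x in e
  ... | true rewrite μ-flips x | e = μ-involutive x
  ... | false rewrite μ-flips x | e = refl

  root-same : ∀ x y → root x ≡ root y → y ≡ x ⊎ y ≡ μ x
  root-same x y r with S x | S y
  ... | true  | true  = inj₁ (sym r)
  ... | true  | false = inj₂ (trans (sym (μ-involutive y)) (cong μ (sym r)))
  ... | false | true  = inj₂ (sym r)
  ... | false | false = inj₁ (trans (sym (μ-involutive y)) (trans (cong μ (sym r)) (μ-involutive x)))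

  sideOf : Bool → Fin 2
  sideOf b = if b then zero else suc zero

  side-μ : ∀ x → sideOf (S (μ x)) ≢ sideOf (S x)
  side-μ x rewrite μ-flips x with S x
  ... | true = λ ()
  ... | false = λ ()

  part : Fin v → Fin s
  part x = fromℕ< (subst (rank S (root x) <_) size (rank-< {f = S} (root-in x)))

  toℕ-part : ∀ x → toℕ (part x) ≡ rank S (root x)
  toℕ-part x = toℕ-fromℕ< _

  part-injective : ∀ x y → part x ≡ part y → root x ≡ root y
  part-injective x y p = rank-injective (root-in x) (root-in y)
    (trans (sym (toℕ-part x)) (trans (cong toℕ p) (toℕ-part y)))

  part-root : ∀ x y → root x ≡ root y → part x ≡ part y
  part-root x y r = toℕ-injective (trans (toℕ-part x) (trans (cong (rank S) r) (sym (toℕ-part y))))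

  toK : Fin v → Fin s × Fin 2
  toK x = part x , sideOf (S x)

  toK-injective : ∀ {x y} → toK x ≡ toK y → x ≡ y
  toK-injective {x} {y} eq with root-same x y (part-injective x y (cong proj₁ eq))
  ... | inj₁ y≡x = sym y≡x
  ... | inj₂ refl = ⊥-elim (side-μ x (sym (cong proj₂ eq)))

  toK-surjective : ∀ (t : Fin s × Fin 2) → ∃ λ x → ∀ {z} → z ≡ x → toK z ≡ t
  toK-surjective (i , b) with rank-surjective {f = S} (toℕ i) (subst (toℕ i <_) (sym size) (toℕ<n i))
  ... | y , y∈S , rank≡i = choose b
    where
    part-y : part y ≡ i
    part-y = toℕ-injective (trans (toℕ-part y) (trans (cong (rank S) (root-member y y∈S)) rank≡i))
    choose : ∀ b → ∃ λ x → ∀ {z} → z ≡ x → toK z ≡ (i , b)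
    choose zero = y , λ { refl → cong₂ _,_ part-y (cong sideOf y∈S) }
    choose (suc zero) = μ y , λ { refl → cong₂ _,_
      (trans (part-root (μ y) y (root-μ y)) part-y)
      (cong sideOf (trans (μ-flips y) (cong not y∈S))) }

  adj-toK : ∀ x y → adj G x y ≡ KAdj s 2 (toK x) (toK y)
  adj-toK x y with part x ≟ part y
  ... | yes same with root-same x y (part-injective x y same)
  ...   | inj₁ refl = irrefl G x
  ...   | inj₂ refl = μ-nonadjacent x
  adj-toK x y | no differ with adj G x y in e
  ...   | true = refl
  ...   | false with nonadjacent⇒μ x y e
  ...     | inj₁ refl = ⊥-elim (differ refl)
  ...     | inj₂ refl = ⊥-elim (differ (part-root x (μ x) (sym (root-μ x))))

  isomorphism : IsoToK G s 2
  isomorphism = mk⤖ {to = toK} (toK-injective , toK-surjective) , adj-toK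

module Configuration {v : ℕ} (G : Graph v) (k l m s : ℕ) (S : Pred v)
  (regular : ∀ x → count (adj G x) ≡ k)
  (edgeRegular : ∀ x y → adj G x y ≡ true → count (adj G x ∩ adj G y) ≡ l)
  (size : count S ≡ s)
  (clique : ∀ x y → S x ≡ true → S y ≡ true → x ≢ y → adj G x y ≡ true)
  (mRegular : ∀ x → S x ≡ false → count (adj G x ∩ S) ≡ m)
  (parameters : k + m ≡ l + s + 1)
  (m≥3 : 3 ≤ m)
  (nonComplete : ¬ Complete G)
  (hasEdge : HasEdge G)
  where

  Nb : Fin v → Pred v
  Nb = adj G

  Nb-sym : ∀ {x y b} → Nb x y ≡ b → Nb y x ≡ b
  Nb-sym {x} {y} xy = trans (Graph.sym G y x) xy

  Outside : Pred v
  Outside z = not (S z)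

  status-≢ : ∀ {x y} → S x ≡ true → S y ≡ false → x ≢ y
  status-≢ x∈S y∉S refl = true≢false (trans (sym x∈S) y∉S)

  nbr-≢ : ∀ {w x y} → Nb w x ≡ true → Nb w y ≡ false → x ≢ y
  nbr-≢ wx wy refl = true≢false (trans (sym wx) wy)

  privateNeighbours : ∀ x y → Nb x y ≡ true → count (Nb x ∖ Nb y) + m ≡ s + 1
  privateNeighbours x y xy = +-cancelˡ-≡ l _ _ (begin
    l + (p + m)                    ≡⟨ +-assoc l p m ⟨
    l + p + m                      ≡⟨ cong (λ t → t + p + m) (edgeRegular x y xy) ⟨
    count (Nb x ∩ Nb y) + p + m    ≡⟨ cong (_+ m) (count-split (Nb x) (Nb y)) ⟨
    count (Nb x) + m               ≡⟨ cong (_+ m) (regular x) ⟩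
    k + m                          ≡⟨ parameters ⟩
    l + s + 1                      ≡⟨ +-assoc l s 1 ⟩
    l + (s + 1)                    ∎)
    where
    open ≡-Reasoning
    p : ℕ
    p = count (Nb x ∖ Nb y)

  missedByOutside : ∀ x → S x ≡ false → count (S ∖ Nb x) + m ≡ s
  missedByOutside x x∉S = begin
    p + m                          ≡⟨ +-comm p m ⟩
    m + p                          ≡⟨ cong (_+ p) (mRegular x x∉S) ⟨
    count (Nb x ∩ S) + p           ≡⟨ cong (_+ p) (count-ext (λ z → ∧-comm (Nb x z) (S z))) ⟩
    count (S ∩ Nb x) + p           ≡⟨ count-split S (Nb x) ⟨
    count S                        ≡⟨ size ⟩
    s                              ∎
    where
    open ≡-Reasoning
    p : ℕ
    p = count (S ∖ Nb x)

  -- If x ∉ S is adjacent to y ∈ S, then every other outside neighbour z of y is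
  -- adjacent to x: otherwise the s − m clique vertices missed by x, together with
  -- x and z, would be s + 2 − m private neighbours of y with respect to x.
  outsideClosure : ∀ {x y z} → S x ≡ false → S y ≡ true → Nb x y ≡ true →
                   S z ≡ false → Nb y z ≡ true → z ≢ x → Nb x z ≡ true
  outsideClosure {x} {y} {z} x∉S y∈S xy z∉S yz z≢x with Nb x z in xz
  ... | true = refl
  ... | false = ⊥-elim (1+n≰n (begin
    2 + count (S ∖ Nb x)  ≤⟨ count-extra₂ x z missed⊆private (λ x≡z → z≢x (sym x≡z))
                               (∧-not-intro (Nb-sym xy) (irrefl G x)) (∧-falseˡ x∉S)
                               (∧-not-intro yz xz) (∧-falseˡ z∉S) ⟩
    count (Nb y ∖ Nb x)   ≡⟨ one-more (privateNeighbours y x (Nb-sym xy)) (missedByOutside x x∉S) ⟩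
    count (S ∖ Nb x) + 1  ≡⟨ +-comm _ 1 ⟩
    1 + count (S ∖ Nb x)  ∎))
    where
    open ≤-Reasoning
    missed⊆private : (S ∖ Nb x) ⊆ (Nb y ∖ Nb x)
    missed⊆private w h = ∧-not-intro
      (clique y w y∈S (proj₁ (∧-not-elim h)) (nbr-≢ xy (proj₂ (∧-not-elim h))))
      (proj₂ (∧-not-elim h))

  -- For distinct y₁, y₂ ∈ S and a neighbour z of y₁: if the private outside
  -- neighbours of y₂ (w.r.t. y₁) are adjacent to z, then N(y₂) ∖ N(y₁) ⊆ N(z) ∖ N(y₁),
  -- and as both have s + 1 − m elements, every private neighbour of z is one of y₂.
  privateTransfer : ∀ {y₁ y₂ z b} → S y₁ ≡ true → S y₂ ≡ true → y₁ ≢ y₂ → Nb z y₁ ≡ true →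
    (∀ w → S w ≡ false → Nb y₂ w ≡ true → Nb y₁ w ≡ false → Nb z w ≡ true) →
    Nb z b ≡ true → Nb y₁ b ≡ false → Nb y₂ b ≡ true
  privateTransfer {y₁} {y₂} {z} {b} y₁∈S y₂∈S y₁≢y₂ zy₁ outsideCase zb y₁b with Nb y₂ b in y₂b
  ... | true = refl
  ... | false = ⊥-elim (1+n≰n (begin
    1 + count (Nb y₂ ∖ Nb y₁) ≤⟨ count-extra b inclusion (∧-not-intro zb y₁b) (∧-falseˡ y₂b) ⟩
    count (Nb z ∖ Nb y₁)      ≡⟨ +-cancelʳ-≡ m _ _ (trans (privateNeighbours z y₁ zy₁)
                                   (sym (privateNeighbours y₂ y₁ y₂y₁))) ⟩
    count (Nb y₂ ∖ Nb y₁)     ∎))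
    where
    open ≤-Reasoning
    y₂y₁ : Nb y₂ y₁ ≡ true
    y₂y₁ = clique y₂ y₁ y₂∈S y₁∈S (≢-sym y₁≢y₂)
    inclusion : (Nb y₂ ∖ Nb y₁) ⊆ (Nb z ∖ Nb y₁)
    inclusion w h with S w in w∈S | ∧-not-elim h
    ... | false | y₂w , y₁w = ∧-not-intro (outsideCase w w∈S y₂w y₁w) y₁w
    ... | true  | _ , y₁w with w ≟ y₁
    ...   | yes refl = ∧-not-intro zy₁ (irrefl G y₁)
    ...   | no w≢y₁ = ⊥-elim (true≢false (trans (sym (clique y₁ w y₁∈S w∈S (≢-sym w≢y₁))) y₁w))

  neighbourOfOutside : ∀ {x u y₁ y₂} → S x ≡ false → Nb x u ≡ true → S y₁ ≡ true → S y₂ ≡ true →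
    y₁ ≢ y₂ → Nb x y₁ ≡ true → Nb x y₂ ≡ true → Nb y₁ u ≡ false → Nb y₂ u ≡ true
  neighbourOfOutside x∉S xu y₁∈S y₂∈S y₁≢y₂ xy₁ xy₂ y₁u =
    privateTransfer y₁∈S y₂∈S y₁≢y₂ xy₁
      (λ w w∉S y₂w y₁w → outsideClosure x∉S y₂∈S xy₂ w∉S y₂w (≢-sym (nbr-≢ (Nb-sym xy₁) y₁w)))
      xu y₁u

  cliqueNeighbourMissing : ∀ {x u y} → ((Nb x ∩ S) ∖ Nb u) y ≡ true →
                           Nb x y ≡ true × S y ≡ true × Nb y u ≡ false
  cliqueNeighbourMissing {x} {u} {y} h =
    proj₁ (∧-elim xy∈S) , proj₂ (∧-elim xy∈S) , Nb-sym (proj₂ (∧-not-elim h))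
    where
    xy∈S : (Nb x ∩ S) y ≡ true
    xy∈S = proj₁ (∧-not-elim h)

  neighbourMissesAtMostOne : ∀ {x u} → S x ≡ false → Nb x u ≡ true → count ((Nb x ∩ S) ∖ Nb u) ≤ 1
  neighbourMissesAtMostOne {x} {u} x∉S xu = count-≤1 noPair
    where
    noPair : ∀ y₁ y₂ → ((Nb x ∩ S) ∖ Nb u) y₁ ≡ true → ((Nb x ∩ S) ∖ Nb u) y₂ ≡ true →
             y₁ ≢ y₂ → ⊥
    noPair y₁ y₂ h₁ h₂ y₁≢y₂ with cliqueNeighbourMissing h₁ | cliqueNeighbourMissing h₂
    ... | xy₁ , y₁∈S , y₁u | xy₂ , y₂∈S , y₂u =
      true≢false (trans (sym (neighbourOfOutside x∉S xu y₁∈S y₂∈S y₁≢y₂ xy₁ xy₂ y₁u)) y₂u)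

  cliqueDegree : ∀ {x} → S x ≡ false → 3 ≤ count (Nb x ∩ S)
  cliqueDegree {x} x∉S = subst (3 ≤_) (sym (mRegular x x∉S)) m≥3

  outsideExists : ∃ λ x → S x ≡ false
  outsideExists with any? (λ x → S x ≟ᵇ false)
  ... | yes found = found
  ... | no none = ⊥-elim (nonComplete (λ x y x≢y → clique x y (inside x) (inside y) x≢y))
    where
    inside : ∀ x → S x ≡ true
    inside x with S x in e
    ... | true = refl
    ... | false = ⊥-elim (none (x , e))

  -- s ≤ λ + 1: two clique neighbours y₁, y₂ of an outside vertex x have all of
  -- S ∖ {y₁, y₂} and x as common neighbours
  cliqueBound : s ≤ suc l
  cliqueBound with outsideExists
  ... | x , x∉S with count-two {f = Nb x ∩ S} (≤-trans (n≤1+n 2) (cliqueDegree x∉S))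
  ... | y₁ , y₂ , y₁≢y₂ , xy₁∈S , xy₂∈S with ∧-elim xy₁∈S | ∧-elim xy₂∈S
  ... | xy₁ , y₁∈S | xy₂ , y₂∈S = ≤-pred (begin
    1 + s                                          ≡⟨ cong suc size ⟨
    1 + count S                                    ≤⟨ count-extra x covered x-covered x∉S ⟩
    count (⁅ y₁ ⁆ ∪ (⁅ y₂ ⁆ ∪ (Nb y₁ ∩ Nb y₂)))     ≤⟨ count-∪ ⁅ y₁ ⁆ _ ⟩
    count ⁅ y₁ ⁆ + count (⁅ y₂ ⁆ ∪ (Nb y₁ ∩ Nb y₂))
      ≤⟨ +-monoʳ-≤ (count ⁅ y₁ ⁆) (count-∪ ⁅ y₂ ⁆ _) ⟩
    count ⁅ y₁ ⁆ + (count ⁅ y₂ ⁆ + count (Nb y₁ ∩ Nb y₂))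
      ≡⟨ cong₂ (λ a b → a + (b + count (Nb y₁ ∩ Nb y₂))) (count-singleton y₁) (count-singleton y₂) ⟩
    2 + count (Nb y₁ ∩ Nb y₂)
      ≡⟨ cong (2 +_) (edgeRegular y₁ y₂ (clique y₁ y₂ y₁∈S y₂∈S y₁≢y₂)) ⟩
    2 + l                                          ∎)
    where
    open ≤-Reasoning
    x-covered : (⁅ y₁ ⁆ ∪ (⁅ y₂ ⁆ ∪ (Nb y₁ ∩ Nb y₂))) x ≡ true
    x-covered = ∨-introʳ {a = ⁅ y₁ ⁆ x} (∨-introʳ {a = ⁅ y₂ ⁆ x} (∧-intro (Nb-sym xy₁) (Nb-sym xy₂)))
    covered : S ⊆ (⁅ y₁ ⁆ ∪ (⁅ y₂ ⁆ ∪ (Nb y₁ ∩ Nb y₂)))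
    covered w w∈S with w ≟ y₁ | w ≟ y₂
    ... | yes _ | _ = refl
    ... | no _ | yes _ = refl
    ... | no w≢y₁ | no w≢y₂ =
      ∧-intro (clique y₁ w y₁∈S w∈S (≢-sym w≢y₁)) (clique y₂ w y₂∈S w∈S (≢-sym w≢y₂))

  lessThanDegree : ∀ {x y} → Nb x y ≡ true → suc l ≤ k
  lessThanDegree {x} {y} xy = begin
    1 + l                   ≡⟨ cong suc (edgeRegular x y xy) ⟨
    1 + count (Nb x ∩ Nb y) ≤⟨ count-extra y (λ z h → proj₁ (∧-elim h)) xy (∧-falseʳ (irrefl G y)) ⟩
    count (Nb x)            ≡⟨ regular x ⟩
    k                       ∎
    where open ≤-Reasoning

  -- each clique vertex has an outside neighbour, since its degree k exceeds s − 1
  outsideDegree : ∀ {y} → S y ≡ true → 1 ≤ count (Nb y ∖ S)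
  outsideDegree {y} y∈S = +-positiveʳ {count (Nb y ∩ S)} {count (Nb y ∖ S)} (begin
    1 + count (Nb y ∩ S)                   ≤⟨ count-extra y (λ z h → proj₂ (∧-elim h)) y∈S
                                                 (∧-falseˡ (irrefl G y)) ⟩
    count S                                ≡⟨ size ⟩
    s                                      ≤⟨ cliqueBound ⟩
    1 + l                                  ≤⟨ lessThanDegree (proj₂ (proj₂ hasEdge)) ⟩
    k                                      ≡⟨ regular y ⟨
    count (Nb y)                           ≡⟨ count-split (Nb y) S ⟩
    count (Nb y ∩ S) + count (Nb y ∖ S)    ∎)
    where open ≤-Reasoning

  outsideNeighbour : ∀ {y} → S y ≡ true → ∃ λ z → S z ≡ false × Nb y z ≡ true
  outsideNeighbour y∈S with count-witness (outsideDegree y∈S)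
  ... | z , h = z , proj₂ (∧-not-elim h) , proj₁ (∧-not-elim h)

  -- two clique vertices have λ ≥ s − 1 common neighbours, so one lies outside S
  commonOutsideDegree : ∀ {y y'} → S y ≡ true → S y' ≡ true → y ≢ y' → 1 ≤ count ((Nb y ∩ Nb y') ∖ S)
  commonOutsideDegree {y} {y'} y∈S y'∈S y≢y' =
    +-positiveʳ {count (Common ∩ S)} {count (Common ∖ S)} (≤-pred (begin
      2 + count (Common ∩ S)                 ≤⟨ count-extra₂ y y' (λ z h → proj₂ (∧-elim h)) y≢y'
                                                 y∈S (∧-falseˡ (∧-falseˡ (irrefl G y)))
                                                 y'∈S (∧-falseˡ (∧-falseʳ {a = Nb y y'} (irrefl G y'))) ⟩
      count S                                ≡⟨ size ⟩
      s                                      ≤⟨ cliqueBound ⟩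
      1 + l                                  ≡⟨ cong suc (edgeRegular y y' (clique y y' y∈S y'∈S y≢y')) ⟨
      1 + count Common                       ≡⟨ cong suc (count-split Common S) ⟩
      1 + (count (Common ∩ S) + count (Common ∖ S)) ∎))
    where
    open ≤-Reasoning
    Common : Pred v
    Common = Nb y ∩ Nb y'

  commonOutsideNeighbour : ∀ {y y'} → S y ≡ true → S y' ≡ true → y ≢ y' →
                           ∃ λ u → S u ≡ false × Nb y u ≡ true × Nb y' u ≡ true
  commonOutsideNeighbour y∈S y'∈S y≢y' with count-witness (commonOutsideDegree y∈S y'∈S y≢y')
  ... | u , h with ∧-not-elim h
  ...   | yy'u , u∉S = u , u∉S , ∧-elim yy'u

  sharedWithNeighbour : ∀ {x u} → S x ≡ false → Nb x u ≡ true → m ≤ count ((Nb x ∩ S) ∩ Nb u) + 1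
  sharedWithNeighbour {x} {u} x∉S xu = begin
    m                                                           ≡⟨ mRegular x x∉S ⟨
    count (Nb x ∩ S)                                            ≡⟨ count-split (Nb x ∩ S) (Nb u) ⟩
    count ((Nb x ∩ S) ∩ Nb u) + count ((Nb x ∩ S) ∖ Nb u)
      ≤⟨ +-monoʳ-≤ _ (neighbourMissesAtMostOne x∉S xu) ⟩
    count ((Nb x ∩ S) ∩ Nb u) + 1                               ∎
    where open ≤-Reasoning

  noCommonCliqueNeighbour : ∀ {x x' z} → S x ≡ false → S x' ≡ false → x ≢ x' → Nb x x' ≡ false →
                            S z ≡ true → Nb x z ≡ true → Nb x' z ≡ false
  noCommonCliqueNeighbour {x} {x'} {z} x∉S x'∉S x≢x' xx' z∈S xz with Nb x' z in x'z
  ... | false = refl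
  ... | true = ⊥-elim (true≢false (trans (sym (outsideClosure x∉S z∈S xz x'∉S (Nb-sym x'z) (≢-sym x≢x'))) xx'))

  cliqueNeighbour : ∀ {x} → S x ≡ false → ∃ λ y → Nb x y ≡ true × S y ≡ true
  cliqueNeighbour {x} x∉S with count-witness {f = Nb x ∩ S} (≤-trans (m≤n+m 1 2) (cliqueDegree x∉S))
  ... | y , xy∈S = y , ∧-elim xy∈S

  -- Two outside vertices with disjoint clique neighbourhoods cannot have a common
  -- outside neighbour u: u would see m − 1 vertices of each, 2m − 2 > m in all.
  disjointCliqueNeighbourhoods : ∀ {x x' u} → S x ≡ false → S x' ≡ false → S u ≡ false →
    (∀ {z} → S z ≡ true → Nb x z ≡ true → Nb x' z ≡ false) → Nb x u ≡ true → Nb x' u ≡ true → ⊥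
  disjointCliqueNeighbourhoods {x} {x'} {u} x∉S x'∉S u∉S apart xu x'u =
    <⇒≱ m≥3 (two-halves (sharedWithNeighbour x∉S xu) (sharedWithNeighbour x'∉S x'u) (begin
      count ((Nb x ∩ S) ∩ Nb u) + count ((Nb x' ∩ S) ∩ Nb u)
        ≤⟨ count-disjoint {h = Nb u ∩ S} (inNbu x) (inNbu x') separate ⟩
      count (Nb u ∩ S)                                        ≡⟨ mRegular u u∉S ⟩
      m                                                       ∎))
    where
    open ≤-Reasoning
    inNbu : ∀ w → ((Nb w ∩ S) ∩ Nb u) ⊆ (Nb u ∩ S)
    inNbu w z h with ∧-elim {a = (Nb w ∩ S) z} h
    ... | wz∈S , uz with ∧-elim {a = Nb w z} wz∈S
    ...   | _ , z∈S = ∧-intro uz z∈S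
    separate : ∀ z → ((Nb x ∩ S) ∩ Nb u) z ≡ true → ((Nb x' ∩ S) ∩ Nb u) z ≡ false
    separate z h with ∧-elim (proj₁ (∧-elim h))
    ... | xz , z∈S = ∧-falseˡ (∧-falseˡ (apart z∈S xz))

  -- Hence outside vertices are pairwise adjacent: for non-adjacent x, x' pick clique
  -- neighbours y of x and y' of x' and a common outside neighbour u of y and y';
  -- outsideClosure makes u adjacent to both x and x'.
  nonAdjacentOutsidePair : ∀ {x x'} → S x ≡ false → S x' ≡ false → x ≢ x' → Nb x x' ≡ false → ⊥
  nonAdjacentOutsidePair {x} {x'} x∉S x'∉S x≢x' xx' =
    throughCliqueNeighbours (cliqueNeighbour x∉S) (cliqueNeighbour x'∉S)
    where
    apart : ∀ {z} → S z ≡ true → Nb x z ≡ true → Nb x' z ≡ false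
    apart = noCommonCliqueNeighbour x∉S x'∉S x≢x' xx'
    apart' : ∀ {z} → S z ≡ true → Nb x' z ≡ true → Nb x z ≡ false
    apart' = noCommonCliqueNeighbour x'∉S x∉S (≢-sym x≢x') (Nb-sym xx')
    throughCliqueNeighbours : (∃ λ y → Nb x y ≡ true × S y ≡ true) →
                              (∃ λ y' → Nb x' y' ≡ true × S y' ≡ true) → ⊥
    throughCliqueNeighbours (y , xy , y∈S) (y' , x'y' , y'∈S) =
      throughCommonNeighbour (commonOutsideNeighbour y∈S y'∈S (nbr-≢ xy (apart' y'∈S x'y')))
      where
      throughCommonNeighbour : (∃ λ u → S u ≡ false × Nb y u ≡ true × Nb y' u ≡ true) → ⊥
      throughCommonNeighbour (u , u∉S , yu , y'u) = disjointCliqueNeighbourhoods x∉S x'∉S u∉S apart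
        (outsideClosure x∉S y∈S xy u∉S yu (nbr-≢ y'u (Nb-sym (apart' y'∈S x'y'))))
        (outsideClosure x'∉S y'∈S x'y' u∉S y'u (nbr-≢ yu (Nb-sym (apart y∈S xy))))

  outsideAdjacent : ∀ {x x'} → S x ≡ false → S x' ≡ false → x ≢ x' → Nb x x' ≡ true
  outsideAdjacent {x} {x'} x∉S x'∉S x≢x' with Nb x x' in xx'
  ... | true = refl
  ... | false = ⊥-elim (nonAdjacentOutsidePair x∉S x'∉S x≢x' xx')

  -- An outside vertex x misses at most one clique vertex: if it missed y and y',
  -- privateTransfer through an outside neighbour z of y' would make y adjacent to x.
  missesAtMostOne : ∀ {x} → S x ≡ false → count (S ∖ Nb x) ≤ 1
  missesAtMostOne {x} x∉S = count-≤1 noPair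
    where
    noPair : ∀ y y' → (S ∖ Nb x) y ≡ true → (S ∖ Nb x) y' ≡ true → y ≢ y' → ⊥
    noPair y y' hy hy' y≢y' = viaNeighbourOf (outsideNeighbour y'∈S)
      where
      y∈S : S y ≡ true
      y∈S = proj₁ (∧-not-elim hy)
      xy : Nb x y ≡ false
      xy = proj₂ (∧-not-elim hy)
      y'∈S : S y' ≡ true
      y'∈S = proj₁ (∧-not-elim hy')
      xy' : Nb x y' ≡ false
      xy' = proj₂ (∧-not-elim hy')
      viaNeighbourOf : (∃ λ z → S z ≡ false × Nb y' z ≡ true) → ⊥
      viaNeighbourOf (z , z∉S , y'z) = true≢false (trans (sym (Nb-sym yx)) xy)
        where
        yx : Nb y x ≡ true
        yx = privateTransfer y'∈S y∈S (≢-sym y≢y') (Nb-sym y'z)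
          (λ w w∉S yw y'w → outsideAdjacent z∉S w∉S (nbr-≢ y'z y'w))
          (outsideAdjacent z∉S x∉S (nbr-≢ y'z (Nb-sym xy'))) (Nb-sym xy')

  -- m ≠ s, for otherwise outside vertices would see all of S and G would be complete
  m≢s : m ≢ s
  m≢s m≡s = nonComplete complete
    where
    nothingMissed : ∀ {x} → S x ≡ false → count (S ∖ Nb x) ≡ 0
    nothingMissed x∉S = +-cancelʳ-≡ m _ 0 (trans (missedByOutside _ x∉S) (sym m≡s))
    adjacentToClique : ∀ {x y} → S x ≡ false → S y ≡ true → Nb x y ≡ true
    adjacentToClique {x} {y} x∉S y∈S with Nb x y in xy
    ... | true = refl
    ... | false = ⊥-elim (1+n≰n (≤-trans (count-nonempty y (∧-not-intro y∈S xy))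
                                         (≤-reflexive (nothingMissed x∉S))))
    complete : Complete G
    complete x y x≢y with S x in x∈S | S y in y∈S
    ... | true  | true  = clique x y x∈S y∈S x≢y
    ... | true  | false = Nb-sym (adjacentToClique y∈S x∈S)
    ... | false | true  = adjacentToClique x∈S y∈S
    ... | false | false = outsideAdjacent x∈S y∈S x≢y

  missesExactlyOne : ∀ {x} → S x ≡ false → count (S ∖ Nb x) ≡ 1
  missesExactlyOne {x} x∉S = ≤-antisym (missesAtMostOne x∉S) (n≢0⇒n>0 missesSome)
    where
    missesSome : count (S ∖ Nb x) ≢ 0
    missesSome none = m≢s (trans (sym (cong (_+ m) none)) (missedByOutside x x∉S))

  s≡1+m : s ≡ 1 + m
  s≡1+m with outsideExists
  ... | x , x∉S = trans (sym (missedByOutside x x∉S)) (cong (_+ m) (missesExactlyOne x∉S))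

  -- Dually, every clique vertex y misses exactly one outside vertex: with an outside
  -- neighbour z, the two private neighbours of z w.r.t. y are y and the outside
  -- vertices not adjacent to y (all adjacent to z).
  privateOfOutsideNeighbour : ∀ {y z} → Nb z y ≡ true → count (Nb z ∖ Nb y) ≡ 2
  privateOfOutsideNeighbour {y} {z} zy = +-cancelʳ-≡ m _ 2 (begin
    count (Nb z ∖ Nb y) + m ≡⟨ privateNeighbours z y zy ⟩
    s + 1                   ≡⟨ cong (_+ 1) s≡1+m ⟩
    suc (m + 1)             ≡⟨ cong suc (+-comm m 1) ⟩
    2 + m                   ∎)
    where open ≡-Reasoning

  outsideNonNeighbour : ∀ {y x} → (Outside ∖ Nb y) x ≡ true → S x ≡ false × Nb y x ≡ false
  outsideNonNeighbour h with ∧-not-elim h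
  ... | x∉S , yx = not-true x∉S , yx

  -- two outside non-neighbours of y would be two more private neighbours of z
  cliqueVertexMissesAtMostOne : ∀ {y} → S y ≡ true → count (Outside ∖ Nb y) ≤ 1
  cliqueVertexMissesAtMostOne {y} y∈S = count-≤1 noPair
    where
    noPair : ∀ x₁ x₂ → (Outside ∖ Nb y) x₁ ≡ true → (Outside ∖ Nb y) x₂ ≡ true →
             x₁ ≢ x₂ → ⊥
    noPair x₁ x₂ h₁ h₂ x₁≢x₂ = viaNeighbourOf (outsideNeighbour y∈S)
      where
      viaNeighbourOf : (∃ λ z → S z ≡ false × Nb y z ≡ true) → ⊥
      viaNeighbourOf (z , z∉S , yz) = 1+n≰n (begin
        3                            ≡⟨ cong (2 +_) (count-singleton y) ⟨
        2 + count ⁅ y ⁆              ≤⟨ count-extra₂ x₁ x₂ onlyY x₁≢x₂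
                                          (inPrivate h₁) (notY h₁) (inPrivate h₂) (notY h₂) ⟩
        count (Nb z ∖ Nb y)          ≡⟨ privateOfOutsideNeighbour (Nb-sym yz) ⟩
        2                            ∎)
        where
        open ≤-Reasoning
        onlyY : ⁅ y ⁆ ⊆ (Nb z ∖ Nb y)
        onlyY w w≡y rewrite ⁅⁆-elim {i = y} {j = w} w≡y = ∧-not-intro (Nb-sym yz) (irrefl G y)
        inPrivate : ∀ {x} → (Outside ∖ Nb y) x ≡ true → (Nb z ∖ Nb y) x ≡ true
        inPrivate h with outsideNonNeighbour h
        ... | x∉S , yx = ∧-not-intro (outsideAdjacent z∉S x∉S (nbr-≢ yz yx)) yx
        notY : ∀ {x} → (Outside ∖ Nb y) x ≡ true → ⁅ y ⁆ x ≡ false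
        notY h = ⁅⁆-other (≢-sym (status-≢ y∈S (proj₁ (outsideNonNeighbour h))))

  -- of the two private neighbours of z, only y lies in S
  cliqueVertexMissesSome : ∀ {y} → S y ≡ true → 1 ≤ count (Outside ∖ Nb y)
  cliqueVertexMissesSome {y} y∈S = viaNeighbourOf (outsideNeighbour y∈S)
    where
    viaNeighbourOf : (∃ λ z → S z ≡ false × Nb y z ≡ true) → 1 ≤ count (Outside ∖ Nb y)
    viaNeighbourOf (z , z∉S , yz) = ≤-trans outsidePrivate (count-mono outside⊆)
      where
      Private : Pred v
      Private = Nb z ∖ Nb y
      privateInS⊆y : (Private ∩ S) ⊆ ⁅ y ⁆
      privateInS⊆y w h with w ≟ y
      ... | yes _ = refl
      ... | no w≢y = ⊥-elim (true≢false (trans (sym (clique y w y∈S w∈S (≢-sym w≢y))) yw))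
        where
        w∈S : S w ≡ true
        w∈S = proj₂ (∧-elim {a = Private w} h)
        yw : Nb y w ≡ false
        yw = proj₂ (∧-not-elim {a = Nb z w} (proj₁ (∧-elim {a = Private w} h)))
      outsidePrivate : 1 ≤ count (Private ∖ S)
      outsidePrivate = +-positiveʳ {count (Private ∩ S)} {count (Private ∖ S)} (begin
        suc (count (Private ∩ S))
          ≤⟨ s≤s (≤-trans (count-mono privateInS⊆y) (≤-reflexive (count-singleton y))) ⟩
        2                                         ≡⟨ privateOfOutsideNeighbour (Nb-sym yz) ⟨
        count Private                             ≡⟨ count-split Private S ⟩
        count (Private ∩ S) + count (Private ∖ S) ∎)
        where open ≤-Reasoning
      outside⊆ : (Private ∖ S) ⊆ (Outside ∖ Nb y)
      outside⊆ w h = ∧-not-intro (cong not (proj₂ (∧-not-elim {a = Private w} h)))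
                                 (proj₂ (∧-not-elim {a = Nb z w} (proj₁ (∧-not-elim {a = Private w} h))))

  cliqueVertexMissesExactlyOne : ∀ {y} → S y ≡ true → count (Outside ∖ Nb y) ≡ 1
  cliqueVertexMissesExactlyOne y∈S = ≤-antisym (cliqueVertexMissesAtMostOne y∈S) (cliqueVertexMissesSome y∈S)

  Mates : Fin v → Pred v
  Mates x z = (S x xor S z) ∧ not (Nb x z)

  mates-count : ∀ x → count (Mates x) ≡ 1
  mates-count x with S x in x∈S
  ... | true = cliqueVertexMissesExactlyOne x∈S
  ... | false = missesExactlyOne x∈S

  mates-sym : ∀ x y → Mates x y ≡ Mates y x
  mates-sym x y = cong₂ _∧_ (xor-comm (S x) (S y)) (cong not (Graph.sym G x y))

  mate : Fin v → Fin v
  mate x = proj₁ (count-witness {f = Mates x} (≤-reflexive (sym (mates-count x))))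

  mate-isMate : ∀ x → Mates x (mate x) ≡ true
  mate-isMate x = proj₂ (count-witness {f = Mates x} (≤-reflexive (sym (mates-count x))))

  mate-unique : ∀ {x y} → Mates x y ≡ true → y ≡ mate x
  mate-unique {x} xy = count-≤1-unique (≤-reflexive (mates-count x)) xy (mate-isMate x)

  mate-flips : ∀ x → S (mate x) ≡ not (S x)
  mate-flips x = xor-true (proj₁ (∧-not-elim {a = S x xor S (mate x)} (mate-isMate x)))

  mate-involutive : ∀ x → mate (mate x) ≡ x
  mate-involutive x = sym (mate-unique (trans (mates-sym (mate x) x) (mate-isMate x)))

  mate-nonadjacent : ∀ x → Nb x (mate x) ≡ false
  mate-nonadjacent x = proj₂ (∧-not-elim {a = S x xor S (mate x)} (mate-isMate x))

  sameSideAdjacent : ∀ {x y} → x ≢ y → S x ≡ S y → Nb x y ≡ true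
  sameSideAdjacent {x} {y} x≢y sameSide = bySide (S x) refl
    where
    bySide : ∀ b → S x ≡ b → Nb x y ≡ true
    bySide true x∈S = clique x y x∈S (trans (sym sameSide) x∈S) x≢y
    bySide false x∉S = outsideAdjacent x∉S (trans (sym sameSide) x∉S) x≢y

  nonadjacent⇒mate : ∀ x y → Nb x y ≡ false → y ≡ x ⊎ y ≡ mate x
  nonadjacent⇒mate x y xy with x ≟ y
  ... | yes x≡y = inj₁ (sym x≡y)
  ... | no x≢y = inj₂ (mate-unique (xor-∧-not differentSides xy))
    where
    differentSides : S x ≢ S y
    differentSides sameSide = true≢false (trans (sym (sameSideAdjacent x≢y sameSide)) xy)

  isomorphism : IsoToK G s 2
  isomorphism = MatchingComplement.isomorphism G S size mate mate-flips mate-involutive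
                  mate-nonadjacent nonadjacent⇒mate

card-tabulate : (f : Pred n) → ∣ tabulate f ∣ ≡ count f
card-tabulate {zero} f = refl
card-tabulate {suc n} f with f zero
... | true = cong suc (card-tabulate (λ i → f (suc i)))
... | false = card-tabulate (λ i → f (suc i))

lookup-false⇒∉ : {S : Subset n} {x : Fin n} → lookup S x ≡ false → x ∉ S
lookup-false⇒∉ x∉S x∈S = true≢false (trans (sym ([]=⇒lookup x∈S)) x∉S)

lemma18 : (v k l m s : ℕ) (G : Graph v) →
    InNG G k l m s →
    k + m ≡ l + s + 1 →
    m ≥ 3 →
    IsoToK G s 2
lemma18 v k l m s G (nonComplete , (hasEdge , regular , edgeRegular) , _ , (S , ∣S∣≡s , (clique , _ , mRegular)))
        parameters m≥3 =
  Configuration.isomorphism G k l m s (lookup S)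
    (λ x → trans (sym (card-tabulate (adj G x))) (regular x))
    (λ x y xy → trans (sym (card-tabulate (adj G x ∩ adj G y))) (edgeRegular x y xy))
    (trans (sym (card-tabulate (lookup S))) (trans (cong ∣_∣ (tabulate∘lookup S)) ∣S∣≡s))
    (λ x y x∈S y∈S → clique x y (lookup⇒[]= x S x∈S) (lookup⇒[]= y S y∈S))
    (λ x x∉S → trans (sym (card-tabulate (adj G x ∩ lookup S))) (mRegular x (lookup-false⇒∉ x∉S)))
    parameters m≥3 nonComplete hasEdge
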